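{- In the semi-definite program $(SDP')$, the linear inequalities $Ax\le b$ (the Fortet inequalities $x_i\ge 0$, $x_i\le x_j$, $x_i\le x_k$, $x_i\ge x_j+x_k-1$ for every $(i,j,k)\in J\times(I\cup J)^2$ with $\mathcal{E}_i=\mathcal{E}_j\cup\mathcal{E}_k$) are redundant, as they are implied by the constraints $X_{ii}=x_i$ for $i\in I\cup J$; $X_{ij}=x_i$ for $(i,j)\in J\times(I\cup J)$ with $\mathcal{E}_j\subset\mathcal{E}_i$; $X_{jk}=x_i$ for $(i,j,k)\in J\times(I\cup J)^2$ with $\mathcal{E}_i=\mathcal{E}_j\cup\mathcal{E}_k$; and $\begin{pmatrix}1 & x^T\\ x & X\end{pmatrix}\succeq 0$.
   Context: Setting: binary polynomial problem over $x\in\{0,1\}^n$, $I=\{1,\dots,n\}$, quadratized with additional variables indexed by $J=\{n+1,\dots,N\}$; $\mathcal{E}_i=\{i\}$ for $i\in I$ and, for $i\in J$, $x_i$ replaces a product $x_{i_1}x_{i_2}$ and $\mathcal{E}_i=\mathcal{E}_{i_1}\cup\mathcal{E}_{i_2}$. The feasible set $\mathcal{F}_{\mathcal{E}}=\{x\in\{0,1\}^N: Ax\le b\}$, where $Ax\le b$ collects the Fortet inequalities above. $(SDP')$ is the problem $\min \langle Q,X\rangle+c^Tx$ over $x\in\mathbb{R}^N$, $X\in S^N$ (symmetric matrices), subject to $X_{ii}-x_i=0$ ($i\in I\cup J$); $-X_{ij}+x_i=0$ ($(i,j)\in J\times(I\cup J)$, $\mathcal{E}_j\subset\mathcal{E}_i$);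 $-X_{jk}+x_i=0$ ($(i,j,k)\in J\times(I\cup J)^2$, $\mathcal{E}_i=\mathcal{E}_j\cup\mathcal{E}_k$); $X_{ij}-X_{kl}=0$ ($(i,j,k,l)\in(I\cup J)^4$, $\mathcal{E}_i\cup\mathcal{E}_j=\mathcal{E}_k\cup\mathcal{E}_l$); $\begin{pmatrix}1 & x^T\\ x & X\end{pmatrix}\succeq 0$; and $Ax\le b$. Here $Q\in S_N$, $c\in\mathbb{R}^N$ define the quadratized objective $x^TQx+c^Tx$. Note that if $\mathcal{E}_i=\mathcal{E}_j\cup\mathcal{E}_k$ then $\mathcal{E}_j\subset\mathcal{E}_i$ and $\mathcal{E}_k\subset\mathcal{E}_i$. -}

module Defs where

open import Level using (Level; _⊔_) renaming (suc to lsuc)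
open import Data.Nat using (ℕ; suc)
import Data.Nat as ℕ
open import Data.Fin using (Fin; toℕ; zero; _↑ˡ_; _↑ʳ_)
import Data.Fin as Fin
open import Data.Fin.Subset using (Subset; ⁅_⁆; _∪_; _⊆_)
open import Data.Product using (Σ; _×_; _,_; ∃₂)
open import Relation.Binary.PropositionalEquality using (_≡_)
open import Relation.Binary.Structures using (IsTotalOrder)
open import Algebra.Bundles using (CommutativeRing)
import Algebra.Definitions.RawMonoid as RM

record OrderedCommutativeRing (c ℓ₁ ℓ₂ : Level) : Set (lsuc (c ⊔ ℓ₁ ⊔ ℓ₂)) where
  field
    commutativeRing : CommutativeRing c ℓ₁
  open CommutativeRing commutativeRing public
  field
    _≤_           : Carrier → Carrier → Set ℓ₂
    isTotalOrder  : IsTotalOrder _≈_ _≤_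
    +-monoˡ-≤     : ∀ {x y} z → x ≤ y → (x + z) ≤ (y + z)
    0≤*           : ∀ {x y} → 0# ≤ x → 0# ≤ y → 0# ≤ (x * y)

module _ {c ℓ₁ ℓ₂} (R : OrderedCommutativeRing c ℓ₁ ℓ₂) where
  open OrderedCommutativeRing R
  open RM +-rawMonoid using (sum)

  Symmetric : ∀ {m} → (Fin m → Fin m → Carrier) → Set ℓ₁
  Symmetric M = ∀ a b → M a b ≈ M b a

  PSD : ∀ {m} → (Fin m → Fin m → Carrier) → Set (c ⊔ ℓ₂)
  PSD {m} M = (v : Fin m → Carrier) →
    0# ≤ sum (λ a → sum (λ b → v a * M a b * v b))

  lift : ∀ {N} → (Fin N → Carrier) → (Fin N → Fin N → Carrier) →
         Fin (suc N) → Fin (suc N) → Carrier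
  lift x X zero    zero    = 1#
  lift x X zero    (Fin.suc j) = x j
  lift x X (Fin.suc i) zero    = x i
  lift x X (Fin.suc i) (Fin.suc j) = X i j

-- Quadratization data: N = n + m variables; indices i < n form I (original
-- variables), the remaining ones form J (added variables).
-- E i ⊆ {1..n} is the set of original variables whose product x_i represents.
InJ : ∀ {n m} → Fin (n ℕ.+ m) → Set
InJ {n} i = n ℕ.≤ toℕ i

record IsQuadratization (n m : ℕ) (E : Fin (n ℕ.+ m) → Subset n) : Set where
  field
    E-orig  : ∀ (i : Fin n) → E (i ↑ˡ m) ≡ ⁅ i ⁆
    E-added : ∀ (k : Fin m) → ∃₂ λ (i₁ i₂ : Fin (n ℕ.+ m)) →
                toℕ i₁ ℕ.< toℕ (n ↑ʳ k) × toℕ i₂ ℕ.< toℕ (n ↑ʳ k) ×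
                E (n ↑ʳ k) ≡ (E i₁ ∪ E i₂)

module Submission where

-- Each Fortet inequality reads 0 ≤ vᵀ M v for the lifted matrix M = (1 xᵀ ; x X) and a
-- signed sum v = ∑ ±eₚ of standard basis vectors, and vᵀ M v = ∑ ±⟨column p of M, v⟩.
-- Writing e₀ for the constant coordinate: v = eᵢ gives xᵢ ≥ 0; v = eⱼ − eᵢ gives xⱼ − xᵢ ≥ 0,
-- since column i is orthogonal to v once Xᵢⱼ = Xⱼᵢ = xᵢ; and v = eᵢ − eⱼ − eₖ + e₀ is
-- orthogonal to the columns i, j and k, leaving column 0, which pairs with v to
-- xᵢ − xⱼ − xₖ + 1.

open import Defs
open import Data.Nat using (ℕ)
import Data.Nat as ℕ
open import Data.Fin using (Fin; zero; suc)
open import Data.Fin.Subset using (Subset; _∪_; _⊆_)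
open import Data.Fin.Subset.Properties using (p⊆p∪q; q⊆p∪q)
open import Data.Product using (_×_; _,_)
open import Relation.Binary.PropositionalEquality as ≡ using (_≡_)
open import Relation.Binary.Structures using (IsTotalOrder)
open import Algebra.Bundles using (CommutativeRing)
import Algebra.Properties.Ring as RingProperties
import Algebra.Properties.CommutativeSemigroup as CommutativeSemigroupProperties
import Algebra.Properties.Semiring.Sum as SemiringSum
import Relation.Binary.Reasoning.Setoid as SetoidReasoning

data Sign : Set where
  plus minus : Sign

module SignedSums {c ℓ} (R : CommutativeRing c ℓ) where
  open CommutativeRing R hiding (zero)
  open RingProperties ring using (-0#≈0#; -‿distribʳ-*; -‿+-comm)
  open SemiringSum semiring using (sum; sum-cong-≋; sum-replicate-zero; ∑-distrib-+)
  open SetoidReasoning setoid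

  signed : Sign → Carrier → Carrier
  signed plus  a = a
  signed minus a = - a

  signed-cong : ∀ s {a b} → a ≈ b → signed s a ≈ signed s b
  signed-cong plus  a≈b = a≈b
  signed-cong minus a≈b = -‿cong a≈b

  *-signed : ∀ s a b → a * signed s b ≈ signed s (a * b)
  *-signed plus  a b = refl
  *-signed minus a b = sym (-‿distribʳ-* a b)

  sum-signed : ∀ {n} s (f : Fin n → Carrier) → sum (λ a → signed s (f a)) ≈ signed s (sum f)
  sum-signed plus f = refl
  sum-signed {ℕ.zero}  minus f = sym -0#≈0#
  sum-signed {ℕ.suc n} minus f =
    trans (+-congˡ (sum-signed minus (λ a → f (suc a))))
          (-‿+-comm (f zero) (sum (λ a → f (suc a))))

  basis : ∀ {n} → Fin n → Fin n → Carrier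
  basis zero    zero    = 1#
  basis zero    (suc _) = 0#
  basis (suc _) zero    = 0#
  basis (suc p) (suc a) = basis p a

  sum-*-basis : ∀ {n} (f : Fin n → Carrier) p → sum (λ a → f a * basis p a) ≈ f p
  sum-*-basis {ℕ.suc n} f zero = begin
    f zero * 1# + sum (λ a → f (suc a) * 0#)
      ≈⟨ +-cong (*-identityʳ _) (sum-cong-≋ (λ a → zeroʳ (f (suc a)))) ⟩
    f zero + sum {n} (λ _ → 0#)
      ≈⟨ +-congˡ (sum-replicate-zero n) ⟩
    f zero + 0#
      ≈⟨ +-identityʳ _ ⟩
    f zero
      ∎
  sum-*-basis f (suc p) =
    trans (+-cong (zeroʳ _) (sum-*-basis (λ a → f (suc a)) p)) (+-identityˡ _)

  infixr 5 _∷_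

  data SignedSum (n : ℕ) : Set where
    [_] : Sign × Fin n → SignedSum n
    _∷_ : Sign × Fin n → SignedSum n → SignedSum n

  vector : ∀ {n} → SignedSum n → Fin n → Carrier
  vector [ s , p ]     a = signed s (basis p a)
  vector ((s , p) ∷ l) a = signed s (basis p a) + vector l a

  ⟨_∣_⟩ : ∀ {n} → (Fin n → Carrier) → SignedSum n → Carrier
  ⟨ f ∣ [ s , p ] ⟩     = signed s (f p)
  ⟨ f ∣ (s , p) ∷ l ⟩ = signed s (f p) + ⟨ f ∣ l ⟩

  ⟨∣⟩-cong : ∀ {n} {f g : Fin n → Carrier} l → (∀ p → f p ≈ g p) → ⟨ f ∣ l ⟩ ≈ ⟨ g ∣ l ⟩
  ⟨∣⟩-cong [ s , p ]     f≈g = signed-cong s (f≈g p)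
  ⟨∣⟩-cong ((s , p) ∷ l) f≈g = +-cong (signed-cong s (f≈g p)) (⟨∣⟩-cong l f≈g)

  sum-*-vector : ∀ {n} (f : Fin n → Carrier) l → sum (λ a → f a * vector l a) ≈ ⟨ f ∣ l ⟩
  sum-*-vector f [ s , p ] =
    trans (sum-cong-≋ (λ a → *-signed s (f a) (basis p a)))
      (trans (sum-signed s (λ a → f a * basis p a)) (signed-cong s (sum-*-basis f p)))
  sum-*-vector f ((s , p) ∷ l) = begin
    sum (λ a → f a * (signed s (basis p a) + vector l a))
      ≈⟨ sum-cong-≋ (λ a → trans (distribˡ (f a) _ _) (+-congʳ (*-signed s (f a) (basis p a)))) ⟩
    sum (λ a → signed s (f a * basis p a) + f a * vector l a)
      ≈⟨ ∑-distrib-+ (λ a → signed s (f a * basis p a)) (λ a → f a * vector l a) ⟩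
    sum (λ a → signed s (f a * basis p a)) + sum (λ a → f a * vector l a)
      ≈⟨ +-cong (trans (sum-signed s (λ a → f a * basis p a)) (signed-cong s (sum-*-basis f p)))
                (sum-*-vector f l) ⟩
    signed s (f p) + ⟨ f ∣ l ⟩
      ∎

  sum-⟨∣⟩ : ∀ {m n} (g : Fin m → Fin n → Carrier) l →
            sum (λ a → ⟨ g a ∣ l ⟩) ≈ ⟨ (λ p → sum (λ a → g a p)) ∣ l ⟩
  sum-⟨∣⟩ g [ s , p ]     = sum-signed s (λ a → g a p)
  sum-⟨∣⟩ g ((s , p) ∷ l) =
    trans (∑-distrib-+ (λ a → signed s (g a p)) (λ a → ⟨ g a ∣ l ⟩))
          (+-cong (sum-signed s (λ a → g a p)) (sum-⟨∣⟩ g l))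

  quadraticForm : ∀ {n} → (Fin n → Fin n → Carrier) → (Fin n → Carrier) → Carrier
  quadraticForm M v = sum (λ a → sum (λ b → v a * M a b * v b))

  quadraticForm-vector : ∀ {n} (M : Fin n → Fin n → Carrier) l →
    quadraticForm M (vector l) ≈ ⟨ (λ q → ⟨ (λ p → M p q) ∣ l ⟩) ∣ l ⟩
  quadraticForm-vector M l = begin
    sum (λ a → sum (λ b → vector l a * M a b * vector l b))
      ≈⟨ sum-cong-≋ (λ a → sum-*-vector (λ b → vector l a * M a b) l) ⟩
    sum (λ a → ⟨ (λ q → vector l a * M a q) ∣ l ⟩)
      ≈⟨ sum-⟨∣⟩ (λ a q → vector l a * M a q) l ⟩
    ⟨ (λ q → sum (λ a → vector l a * M a q)) ∣ l ⟩
      ≈⟨ ⟨∣⟩-cong l (λ q → trans (sum-cong-≋ (λ a → *-comm (vector l a) (M a q)))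
                                 (sum-*-vector (λ p → M p q) l)) ⟩
    ⟨ (λ q → ⟨ (λ p → M p q) ∣ l ⟩) ∣ l ⟩
      ∎

module CommutativeRingIdentities {c ℓ} (R : CommutativeRing c ℓ) where
  open CommutativeRing R
  open RingProperties ring using (-0#≈0#; -‿involutive; -‿+-comm)
  open CommutativeSemigroupProperties +-commutativeSemigroup using (x∙yz≈y∙xz)
  open SetoidReasoning setoid

  a-a-b+b≈0 : ∀ a b → a + (- a + (- b + b)) ≈ 0#
  a-a-b+b≈0 a b = begin
    a + (- a + (- b + b)) ≈⟨ +-congˡ (+-congˡ (-‿inverseˡ b)) ⟩
    a + (- a + 0#)        ≈⟨ +-congˡ (+-identityʳ (- a)) ⟩
    a - a                 ≈⟨ -‿inverseʳ a ⟩
    0#                    ∎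

  a-b-a+b≈0 : ∀ a b → a + (- b + (- a + b)) ≈ 0#
  a-b-a+b≈0 a b = trans (+-congˡ (x∙yz≈y∙xz (- b) (- a) b)) (a-a-b+b≈0 a b)

  0-0-0+a≈a : ∀ {a b c d} → a ≈ 0# → b ≈ 0# → c ≈ 0# → a + (- b + (- c + d)) ≈ d
  0-0-0+a≈a {a} {b} {c} {d} a≈0 b≈0 c≈0 = begin
    a + (- b + (- c + d))    ≈⟨ +-cong a≈0 (+-cong (-‿cong b≈0) (+-congʳ (-‿cong c≈0))) ⟩
    0# + (- 0# + (- 0# + d)) ≈⟨ +-identityˡ _ ⟩
    - 0# + (- 0# + d)        ≈⟨ +-cong -0#≈0# (+-congʳ -0#≈0#) ⟩
    0# + (0# + d)            ≈⟨ trans (+-identityˡ _) (+-identityˡ d) ⟩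
    d                        ∎

  a-b-c+1≈a-[b+c-1] : ∀ a b c → a + (- b + (- c + 1#)) ≈ a - ((b + c) - 1#)
  a-b-c+1≈a-[b+c-1] a b c = +-congˡ (begin
    - b + (- c + 1#)        ≈⟨ sym (+-assoc (- b) (- c) 1#) ⟩
    (- b + - c) + 1#        ≈⟨ +-cong (-‿+-comm b c) (sym (-‿involutive 1#)) ⟩
    - (b + c) + - - 1#      ≈⟨ -‿+-comm (b + c) (- 1#) ⟩
    - ((b + c) - 1#)        ∎)

module FortetInequalities {c ℓ₁ ℓ₂} (R : OrderedCommutativeRing c ℓ₁ ℓ₂) where
  open OrderedCommutativeRing R hiding (zero)
  open SignedSums commutativeRing
  open CommutativeRingIdentities commutativeRing
  open RingProperties ring using (-0#≈0#)
  open IsTotalOrder isTotalOrder using (≤-respˡ-≈; ≤-respʳ-≈)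
  open SetoidReasoning setoid

  0≤a-b⇒b≤a : ∀ {a b} → 0# ≤ (a - b) → b ≤ a
  0≤a-b⇒b≤a {a} {b} 0≤a-b = ≤-respˡ-≈ (+-identityˡ b) (≤-respʳ-≈ a-b+b≈a (+-monoˡ-≤ b 0≤a-b))
    where
    a-b+b≈a : (a - b) + b ≈ a
    a-b+b≈a = trans (+-assoc a (- b) b) (trans (+-congˡ (-‿inverseˡ b)) (+-identityʳ a))

  PSD⇒0≤⟨∣⟩ : ∀ {n} (M : Fin n → Fin n → Carrier) → PSD R M →
              ∀ l → 0# ≤ ⟨ (λ q → ⟨ (λ p → M p q) ∣ l ⟩) ∣ l ⟩
  PSD⇒0≤⟨∣⟩ M psd l = ≤-respʳ-≈ (quadraticForm-vector M l) (psd (vector l))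

  module SDPConstraints {n} (x : Fin n → Carrier) (X : Fin n → Fin n → Carrier)
           (X-sym : Symmetric R X) (X-diag : ∀ i → X i i ≈ x i)
           (psd : PSD R (lift R x X)) where

    column : SignedSum (ℕ.suc n) → Fin (ℕ.suc n) → Carrier
    column l q = ⟨ (λ p → lift R x X p q) ∣ l ⟩

    0≤⟨column∣⟩ : ∀ l → 0# ≤ ⟨ column l ∣ l ⟩
    0≤⟨column∣⟩ = PSD⇒0≤⟨∣⟩ (lift R x X) psd

    0≤xᵢ : ∀ i → 0# ≤ x i
    0≤xᵢ i = ≤-respʳ-≈ (X-diag i) (0≤⟨column∣⟩ [ plus , suc i ])

    Xᵢⱼ≈xᵢ⇒xᵢ≤xⱼ : ∀ {i j} → X i j ≈ x i → x i ≤ x j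
    Xᵢⱼ≈xᵢ⇒xᵢ≤xⱼ {i} {j} Xᵢⱼ≈xᵢ =
      0≤a-b⇒b≤a (≤-respʳ-≈ quadraticForm≈xⱼ-xᵢ (0≤⟨column∣⟩ l))
      where
      l : SignedSum (ℕ.suc n)
      l = (plus , suc j) ∷ [ minus , suc i ]

      quadraticForm≈xⱼ-xᵢ : ⟨ column l ∣ l ⟩ ≈ x j - x i
      quadraticForm≈xⱼ-xᵢ = begin
        (X j j - X i j) - (X j i - X i i)
          ≈⟨ +-cong (+-cong (X-diag j) (-‿cong Xᵢⱼ≈xᵢ))
                    (-‿cong (+-cong (trans (X-sym j i) Xᵢⱼ≈xᵢ) (-‿cong (X-diag i)))) ⟩
        (x j - x i) - (x i - x i)
          ≈⟨ +-congˡ (trans (-‿cong (-‿inverseʳ (x i))) -0#≈0#) ⟩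
        (x j - x i) + 0#
          ≈⟨ +-identityʳ _ ⟩
        x j - x i
          ∎

    xⱼ+xₖ-1≤xᵢ : ∀ {i j k} → X i j ≈ x i → X i k ≈ x i → X j k ≈ x i →
                 ((x j + x k) - 1#) ≤ x i
    xⱼ+xₖ-1≤xᵢ {i} {j} {k} Xᵢⱼ≈xᵢ Xᵢₖ≈xᵢ Xⱼₖ≈xᵢ =
      0≤a-b⇒b≤a (≤-respʳ-≈ quadraticForm≈xᵢ-[xⱼ+xₖ-1] (0≤⟨column∣⟩ l))
      where
      l : SignedSum (ℕ.suc n)
      l = (plus , suc i) ∷ (minus , suc j) ∷ (minus , suc k) ∷ [ plus , zero ]

      column-i≈0 : column l (suc i) ≈ 0#
      column-i≈0 = trans
        (+-cong (X-diag i) (+-cong (-‿cong (trans (X-sym j i) Xᵢⱼ≈xᵢ))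
                                   (+-congʳ (-‿cong (trans (X-sym k i) Xᵢₖ≈xᵢ)))))
        (a-a-b+b≈0 (x i) (x i))

      column-j≈0 : column l (suc j) ≈ 0#
      column-j≈0 = trans
        (+-cong Xᵢⱼ≈xᵢ (+-cong (-‿cong (X-diag j)) (+-congʳ (-‿cong (trans (X-sym k j) Xⱼₖ≈xᵢ)))))
        (a-b-a+b≈0 (x i) (x j))

      column-k≈0 : column l (suc k) ≈ 0#
      column-k≈0 = trans
        (+-cong Xᵢₖ≈xᵢ (+-cong (-‿cong Xⱼₖ≈xᵢ) (+-congʳ (-‿cong (X-diag k)))))
        (a-a-b+b≈0 (x i) (x k))

      quadraticForm≈xᵢ-[xⱼ+xₖ-1] : ⟨ column l ∣ l ⟩ ≈ x i - ((x j + x k) - 1#)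
      quadraticForm≈xᵢ-[xⱼ+xₖ-1] =
        trans (0-0-0+a≈a column-i≈0 column-j≈0 column-k≈0) (a-b-c+1≈a-[b+c-1] (x i) (x j) (x k))

lemma2 : ∀ {c ℓ₁ ℓ₂} (R : OrderedCommutativeRing c ℓ₁ ℓ₂) →
    let open OrderedCommutativeRing R in
    (n m : ℕ) (E : Fin (n ℕ.+ m) → Subset n) → IsQuadratization n m E →
    (x : Fin (n ℕ.+ m) → Carrier) (X : Fin (n ℕ.+ m) → Fin (n ℕ.+ m) → Carrier) →
    Symmetric R X →
    (∀ i → X i i ≈ x i) →
    (∀ i j → InJ {n} {m} i → E j ⊆ E i → X i j ≈ x i) →
    (∀ i j k → InJ {n} {m} i → E i ≡ (E j ∪ E k) → X j k ≈ x i) →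
    PSD R (lift R x X) →
    ∀ i j k → InJ {n} {m} i → E i ≡ (E j ∪ E k) →
      (0# ≤ x i) × (x i ≤ x j) × (x i ≤ x k) × (((x j + x k) - 1#) ≤ x i)
lemma2 R n m E _ x X X-sym X-diag X-sub X-union psd i j k i∈J Eᵢ≡Eⱼ∪Eₖ =
  0≤xᵢ i , Xᵢⱼ≈xᵢ⇒xᵢ≤xⱼ Xᵢⱼ≈xᵢ , Xᵢⱼ≈xᵢ⇒xᵢ≤xⱼ Xᵢₖ≈xᵢ , xⱼ+xₖ-1≤xᵢ Xᵢⱼ≈xᵢ Xᵢₖ≈xᵢ Xⱼₖ≈xᵢ
  where
  open OrderedCommutativeRing R using (_≈_)
  open FortetInequalities R
  open SDPConstraints x X X-sym X-diag psd

  Xᵢⱼ≈xᵢ : X i j ≈ x i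
  Xᵢⱼ≈xᵢ = X-sub i j i∈J (≡.subst (E j ⊆_) (≡.sym Eᵢ≡Eⱼ∪Eₖ) (p⊆p∪q (E k)))

  Xᵢₖ≈xᵢ : X i k ≈ x i
  Xᵢₖ≈xᵢ = X-sub i k i∈J (≡.subst (E k ⊆_) (≡.sym Eᵢ≡Eⱼ∪Eₖ) (q⊆p∪q (E j) (E k)))

  Xⱼₖ≈xᵢ : X j k ≈ x i
  Xⱼₖ≈xᵢ = X-union i j k i∈J Eᵢ≡Eⱼ∪Eₖ
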